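{- (Strong normalization of $\mathbf{KP}$.) If $\Gamma\vdash_{\mathbf{KP}} t:A$, then $t$ is strongly normalizing with respect to $\to_{\mathbf{KP}}$.
   Context: Formulas are built from propositional atoms and $\bot$ using $\to,\land,\lor$; $\neg B$ abbreviates $B\to\bot$. $\mathbf{KP}$-terms: $t,s,u ::= x \mid t\,s \mid \lambda x.t \mid \mathtt{efq}(t) \mid \langle t,s\rangle \mid \pi_i t \mid \mathtt{in}_i t \mid \mathtt{case}\ t\ [y.s_1]\ [y.s_2] \mid \mathtt{hop}(x.t,\ y.s_1,\ y.s_2)$ ($i\in\{1,2\}$), with $x$ bound in $t$ and $y$ in $s_1,s_2$ in $\mathtt{hop}$; $t\{x:=s\}$ is capture-avoiding substitution. $\Gamma\vdash_{\mathbf{KP}} t:A$ is derived by the standard natural-deduction rules of intuitionistic propositional logic (axiom for declared variables; $\lambda$ for $\to_I$; application for $\to_E$; pairs for $\land_I$; $\pi_i t:A_i$ from $t:A_1\land A_2$; $\mathtt{in}_i t:A_1\lor A_2$ from $t:A_i$; $\mathtt{case}\,t\,[y.s_1][y.s_2]:D$ from $\Gamma\vdash t:A_1\lor A_2$ and $\Gamma,y:A_i\vdash s_i:D$; $\mathtt{efq}(t):A$ from $t:\bot$) plus the Harrop rule: from $\Gamma,x:\neg B\vdash t:A_1\lor A_2$, $\Gamma,y:\neg B\to A_1\vdash s_1:D$, $\Gamma,y:\neg B\to A_2\vdash s_2:D$ infer $\Gamma\vdash\mathtt{hop}(x.t,y.s_1,y.s_2):D$. Weak head contexts: $W::=\Box\mid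 W\,t\mid\pi_i W\mid\mathtt{case}\ W\ [y.s_1]\ [y.s_2]$. Top-level reduction: $(\lambda x.t)s\mapsto t\{x:=s\}$; $\pi_i\langle t_1,t_2\rangle\mapsto t_i$; $\mathtt{case}\,(\mathtt{in}_i t)\,[y.s_1][y.s_2]\mapsto s_i\{y:=t\}$; $\mathtt{hop}(x.\mathtt{in}_i t,y.s_1,y.s_2)\mapsto s_i\{y:=\lambda x.t\}$; $\mathtt{hop}(x.W\langle\mathtt{efq}(t)\rangle,y.s_1,y.s_2)\mapsto s_1\{y:=\lambda x.\mathtt{efq}(t)\}$; $\to_{\mathbf{KP}}$ is its closure under all term constructors. Strongly normalizing means every $\to_{\mathbf{KP}}$-reduction sequence starting from the term is finite. -}

module Defs where

open import Data.Nat using (ℕ; zero; suc)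
open import Data.List using (List; []; _∷_)

infixr 6 _⇒_
infixr 7 _∨_
infixr 8 _∧_

data Formula : Set where
  atom : ℕ → Formula
  ⊥'   : Formula
  _⇒_  : Formula → Formula → Formula
  _∧_  : Formula → Formula → Formula
  _∨_  : Formula → Formula → Formula

¬' : Formula → Formula
¬' B = B ⇒ ⊥'

-- KP-terms, de Bruijn indices (binders: lam, case branches, hop)

data Fin2 : Set where
  one two : Fin2

data Term : Set where
  var  : ℕ → Term
  app  : Term → Term → Term
  lam  : Term → Term
  efq  : Term → Term
  pair : Term → Term → Term
  proj : Fin2 → Term → Term
  inj  : Fin2 → Term → Term
  case : Term → Term → Term → Term         -- case t [y.s₁] [y.s₂]
  hop  : Term → Term → Term → Term         -- hop(x.t, y.s₁, y.s₂)

ext : (ℕ → ℕ) → ℕ → ℕ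
ext ρ zero    = zero
ext ρ (suc n) = suc (ρ n)

rename : (ℕ → ℕ) → Term → Term
rename ρ (var n)      = var (ρ n)
rename ρ (app t s)    = app (rename ρ t) (rename ρ s)
rename ρ (lam t)      = lam (rename (ext ρ) t)
rename ρ (efq t)      = efq (rename ρ t)
rename ρ (pair t s)   = pair (rename ρ t) (rename ρ s)
rename ρ (proj i t)   = proj i (rename ρ t)
rename ρ (inj i t)    = inj i (rename ρ t)
rename ρ (case t s u) = case (rename ρ t) (rename (ext ρ) s) (rename (ext ρ) u)
rename ρ (hop t s u)  = hop (rename (ext ρ) t) (rename (ext ρ) s) (rename (ext ρ) u)

exts : (ℕ → Term) → ℕ → Term
exts σ zero    = var zero
exts σ (suc n) = rename suc (σ n)

subst : (ℕ → Term) → Term → Term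
subst σ (var n)      = σ n
subst σ (app t s)    = app (subst σ t) (subst σ s)
subst σ (lam t)      = lam (subst (exts σ) t)
subst σ (efq t)      = efq (subst σ t)
subst σ (pair t s)   = pair (subst σ t) (subst σ s)
subst σ (proj i t)   = proj i (subst σ t)
subst σ (inj i t)    = inj i (subst σ t)
subst σ (case t s u) = case (subst σ t) (subst (exts σ) s) (subst (exts σ) u)
subst σ (hop t s u)  = hop (subst (exts σ) t) (subst (exts σ) s) (subst (exts σ) u)

-- t [ s ] is t{x:=s} where x is the outermost-bound variable (index 0)
_[_] : Term → Term → Term
t [ s ] = subst σ t
  where
  σ : ℕ → Term
  σ zero    = s
  σ (suc n) = var n

-- Typing  Γ ⊢ t ∶ A   (contexts are lists; index 0 is the last declared)

Context : Set
Context = List Formula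

data _∋_∶_ : Context → ℕ → Formula → Set where
  here  : ∀ {Γ A} → (A ∷ Γ) ∋ zero ∶ A
  there : ∀ {Γ A B n} → Γ ∋ n ∶ A → (B ∷ Γ) ∋ suc n ∶ A

pick : Fin2 → Formula → Formula → Formula
pick one A B = A
pick two A B = B

infix 4 _⊢_∶_
data _⊢_∶_ : Context → Term → Formula → Set where
  ax    : ∀ {Γ n A} → Γ ∋ n ∶ A → Γ ⊢ var n ∶ A
  ⇒I    : ∀ {Γ t A B} → (A ∷ Γ) ⊢ t ∶ B → Γ ⊢ lam t ∶ A ⇒ B
  ⇒E    : ∀ {Γ t s A B} → Γ ⊢ t ∶ A ⇒ B → Γ ⊢ s ∶ A → Γ ⊢ app t s ∶ B
  ∧I    : ∀ {Γ t s A B} → Γ ⊢ t ∶ A → Γ ⊢ s ∶ B → Γ ⊢ pair t s ∶ A ∧ B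
  ∧E    : ∀ {Γ t A₁ A₂} (i : Fin2) → Γ ⊢ t ∶ A₁ ∧ A₂ → Γ ⊢ proj i t ∶ pick i A₁ A₂
  ∨I    : ∀ {Γ t A₁ A₂} (i : Fin2) → Γ ⊢ t ∶ pick i A₁ A₂ → Γ ⊢ inj i t ∶ A₁ ∨ A₂
  ∨E    : ∀ {Γ t s₁ s₂ A₁ A₂ D} → Γ ⊢ t ∶ A₁ ∨ A₂ →
          (A₁ ∷ Γ) ⊢ s₁ ∶ D → (A₂ ∷ Γ) ⊢ s₂ ∶ D → Γ ⊢ case t s₁ s₂ ∶ D
  ⊥E    : ∀ {Γ t A} → Γ ⊢ t ∶ ⊥' → Γ ⊢ efq t ∶ A
  harrop : ∀ {Γ t s₁ s₂ A₁ A₂ B D} →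
          (¬' B ∷ Γ) ⊢ t ∶ A₁ ∨ A₂ →
          ((¬' B ⇒ A₁) ∷ Γ) ⊢ s₁ ∶ D →
          ((¬' B ⇒ A₂) ∷ Γ) ⊢ s₂ ∶ D →
          Γ ⊢ hop t s₁ s₂ ∶ D

data WCtx : Set where
  □     : WCtx
  appW  : WCtx → Term → WCtx
  projW : Fin2 → WCtx → WCtx
  caseW : WCtx → Term → Term → WCtx

plug : WCtx → Term → Term
plug □             u = u
plug (appW W t)    u = app (plug W u) t
plug (projW i W)   u = proj i (plug W u)
plug (caseW W s t) u = case (plug W u) s t

select : Fin2 → Term → Term → Term
select one a b = a
select two a b = b

infix 4 _↦_ _⟶_
data _↦_ : Term → Term → Set where
  β-⇒   : ∀ {t s} → app (lam t) s ↦ t [ s ]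
  β-∧   : ∀ {i t₁ t₂} → proj i (pair t₁ t₂) ↦ select i t₁ t₂
  β-∨   : ∀ {i t s₁ s₂} → case (inj i t) s₁ s₂ ↦ select i s₁ s₂ [ t ]
  hop-in  : ∀ {i t s₁ s₂} → hop (inj i t) s₁ s₂ ↦ select i s₁ s₂ [ lam t ]
  hop-efq : ∀ {W t s₁ s₂} → hop (plug W (efq t)) s₁ s₂ ↦ s₁ [ lam (efq t) ]

data _⟶_ : Term → Term → Set where
  top   : ∀ {t t'} → t ↦ t' → t ⟶ t'
  appˡ  : ∀ {t t' s} → t ⟶ t' → app t s ⟶ app t' s
  appʳ  : ∀ {t s s'} → s ⟶ s' → app t s ⟶ app t s'
  lamξ  : ∀ {t t'} → t ⟶ t' → lam t ⟶ lam t'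
  efqξ  : ∀ {t t'} → t ⟶ t' → efq t ⟶ efq t'
  pairˡ : ∀ {t t' s} → t ⟶ t' → pair t s ⟶ pair t' s
  pairʳ : ∀ {t s s'} → s ⟶ s' → pair t s ⟶ pair t s'
  projξ : ∀ {i t t'} → t ⟶ t' → proj i t ⟶ proj i t'
  injξ  : ∀ {i t t'} → t ⟶ t' → inj i t ⟶ inj i t'
  case₀ : ∀ {t t' s₁ s₂} → t ⟶ t' → case t s₁ s₂ ⟶ case t' s₁ s₂
  case₁ : ∀ {t s₁ s₁' s₂} → s₁ ⟶ s₁' → case t s₁ s₂ ⟶ case t s₁' s₂
  case₂ : ∀ {t s₁ s₂ s₂'} → s₂ ⟶ s₂' → case t s₁ s₂ ⟶ case t s₁ s₂'
  hop₀  : ∀ {t t' s₁ s₂} → t ⟶ t' → hop t s₁ s₂ ⟶ hop t' s₁ s₂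
  hop₁  : ∀ {t s₁ s₁' s₂} → s₁ ⟶ s₁' → hop t s₁ s₂ ⟶ hop t s₁' s₂
  hop₂  : ∀ {t s₁ s₂ s₂'} → s₂ ⟶ s₂' → hop t s₁ s₂ ⟶ hop t s₁ s₂'

-- Strong normalization (inductive / accessibility formulation):
-- t is SN iff all its one-step reducts are SN, i.e. t is accessible
-- for the converse of ⟶; equivalently no infinite reduction sequence
-- starts from t.

data SN (t : Term) : Set where
  sn : (∀ {u} → t ⟶ u → SN u) → SN t

module Submission where

-- Strong normalization of KP by Tait–Girard reducibility.
--
-- Each formula A is interpreted as a set of terms Red A: strongly
-- normalizing terms at atoms and ⊥, the usual function space at ⇒, both
-- projections reducible at ∧, and at ∨ the SN terms all of whose reducts
-- of the form inj i u have u reducible at the i-th disjunct.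

open import Defs
open import Data.Nat using (ℕ; zero; suc)
open import Data.List using (_∷_)
open import Data.Product using (_×_; _,_; proj₁; proj₂)
open import Function using (_∘_)
open import Relation.Binary.PropositionalEquality
  using (_≡_; refl; sym; trans; cong; cong₂; _≗_; module ≡-Reasoning)
import Relation.Binary.PropositionalEquality as ≡
open import Relation.Binary.Construct.Closure.ReflexiveTransitive using (Star; ε; _◅_)

cong₃ : ∀ {A B C D : Set} (f : A → B → C → D) {a a' b b' c c'} →
        a ≡ a' → b ≡ b' → c ≡ c' → f a b c ≡ f a' b' c'
cong₃ f refl refl refl = refl

-- Substitution algebra.  Each fusion law is stated for an arbitrary
-- pointwise description of the composite, so that the induction passes
-- under binders by lifting that description.

ext-fusion : ∀ {ρ ρ' ρ'' : ℕ → ℕ} → ρ ∘ ρ' ≗ ρ'' → ext ρ ∘ ext ρ' ≗ ext ρ''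
ext-fusion e zero    = refl
ext-fusion e (suc n) = cong suc (e n)

rename-fusion : ∀ {ρ ρ' ρ''} → ρ ∘ ρ' ≗ ρ'' → ∀ t → rename ρ (rename ρ' t) ≡ rename ρ'' t
rename-fusion e (var n)      = cong var (e n)
rename-fusion e (app t s)    = cong₂ app (rename-fusion e t) (rename-fusion e s)
rename-fusion e (lam t)      = cong lam (rename-fusion (ext-fusion e) t)
rename-fusion e (efq t)      = cong efq (rename-fusion e t)
rename-fusion e (pair t s)   = cong₂ pair (rename-fusion e t) (rename-fusion e s)
rename-fusion e (proj i t)   = cong (proj i) (rename-fusion e t)
rename-fusion e (inj i t)    = cong (inj i) (rename-fusion e t)
rename-fusion e (case t s u) =
  cong₃ case (rename-fusion e t) (rename-fusion (ext-fusion e) s) (rename-fusion (ext-fusion e) u)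
rename-fusion e (hop t s u)  =
  cong₃ hop (rename-fusion (ext-fusion e) t) (rename-fusion (ext-fusion e) s) (rename-fusion (ext-fusion e) u)

exts-ext-fusion : ∀ {σ τ ρ} → σ ∘ ρ ≗ τ → exts σ ∘ ext ρ ≗ exts τ
exts-ext-fusion e zero    = refl
exts-ext-fusion e (suc n) = cong (rename suc) (e n)

subst-rename-fusion : ∀ {σ τ ρ} → σ ∘ ρ ≗ τ → ∀ t → subst σ (rename ρ t) ≡ subst τ t
subst-rename-fusion e (var n)      = e n
subst-rename-fusion e (app t s)    = cong₂ app (subst-rename-fusion e t) (subst-rename-fusion e s)
subst-rename-fusion e (lam t)      = cong lam (subst-rename-fusion (exts-ext-fusion e) t)
subst-rename-fusion e (efq t)      = cong efq (subst-rename-fusion e t)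
subst-rename-fusion e (pair t s)   = cong₂ pair (subst-rename-fusion e t) (subst-rename-fusion e s)
subst-rename-fusion e (proj i t)   = cong (proj i) (subst-rename-fusion e t)
subst-rename-fusion e (inj i t)    = cong (inj i) (subst-rename-fusion e t)
subst-rename-fusion e (case t s u) = cong₃ case (subst-rename-fusion e t)
  (subst-rename-fusion (exts-ext-fusion e) s) (subst-rename-fusion (exts-ext-fusion e) u)
subst-rename-fusion e (hop t s u)  = cong₃ hop (subst-rename-fusion (exts-ext-fusion e) t)
  (subst-rename-fusion (exts-ext-fusion e) s) (subst-rename-fusion (exts-ext-fusion e) u)

rename-weaken : ∀ ρ t → rename (ext ρ) (rename suc t) ≡ rename suc (rename ρ t)
rename-weaken ρ t = trans (rename-fusion (λ _ → refl) t) (sym (rename-fusion (λ _ → refl) t))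

ext-exts-fusion : ∀ {ρ σ τ} → rename ρ ∘ σ ≗ τ → rename (ext ρ) ∘ exts σ ≗ exts τ
ext-exts-fusion e zero               = refl
ext-exts-fusion {ρ} {σ} e (suc n) = trans (rename-weaken ρ (σ n)) (cong (rename suc) (e n))

rename-subst-fusion : ∀ {ρ σ τ} → rename ρ ∘ σ ≗ τ → ∀ t → rename ρ (subst σ t) ≡ subst τ t
rename-subst-fusion e (var n)      = e n
rename-subst-fusion e (app t s)    = cong₂ app (rename-subst-fusion e t) (rename-subst-fusion e s)
rename-subst-fusion e (lam t)      = cong lam (rename-subst-fusion (ext-exts-fusion e) t)
rename-subst-fusion e (efq t)      = cong efq (rename-subst-fusion e t)
rename-subst-fusion e (pair t s)   = cong₂ pair (rename-subst-fusion e t) (rename-subst-fusion e s)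
rename-subst-fusion e (proj i t)   = cong (proj i) (rename-subst-fusion e t)
rename-subst-fusion e (inj i t)    = cong (inj i) (rename-subst-fusion e t)
rename-subst-fusion e (case t s u) = cong₃ case (rename-subst-fusion e t)
  (rename-subst-fusion (ext-exts-fusion e) s) (rename-subst-fusion (ext-exts-fusion e) u)
rename-subst-fusion e (hop t s u)  = cong₃ hop (rename-subst-fusion (ext-exts-fusion e) t)
  (rename-subst-fusion (ext-exts-fusion e) s) (rename-subst-fusion (ext-exts-fusion e) u)

subst-weaken : ∀ σ t → subst (exts σ) (rename suc t) ≡ rename suc (subst σ t)
subst-weaken σ t = trans (subst-rename-fusion (λ _ → refl) t) (sym (rename-subst-fusion (λ _ → refl) t))

exts-fusion : ∀ {σ τ θ} → subst σ ∘ τ ≗ θ → subst (exts σ) ∘ exts τ ≗ exts θ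
exts-fusion e zero                = refl
exts-fusion {σ} {τ} e (suc n) = trans (subst-weaken σ (τ n)) (cong (rename suc) (e n))

subst-fusion : ∀ {σ τ θ} → subst σ ∘ τ ≗ θ → ∀ t → subst σ (subst τ t) ≡ subst θ t
subst-fusion e (var n)      = e n
subst-fusion e (app t s)    = cong₂ app (subst-fusion e t) (subst-fusion e s)
subst-fusion e (lam t)      = cong lam (subst-fusion (exts-fusion e) t)
subst-fusion e (efq t)      = cong efq (subst-fusion e t)
subst-fusion e (pair t s)   = cong₂ pair (subst-fusion e t) (subst-fusion e s)
subst-fusion e (proj i t)   = cong (proj i) (subst-fusion e t)
subst-fusion e (inj i t)    = cong (inj i) (subst-fusion e t)
subst-fusion e (case t s u) =
  cong₃ case (subst-fusion e t) (subst-fusion (exts-fusion e) s) (subst-fusion (exts-fusion e) u)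
subst-fusion e (hop t s u)  =
  cong₃ hop (subst-fusion (exts-fusion e) t) (subst-fusion (exts-fusion e) s) (subst-fusion (exts-fusion e) u)

exts-id : ∀ {σ} → σ ≗ var → exts σ ≗ var
exts-id e zero    = refl
exts-id e (suc n) = cong (rename suc) (e n)

subst-id : ∀ {σ} → σ ≗ var → ∀ t → subst σ t ≡ t
subst-id e (var n)      = e n
subst-id e (app t s)    = cong₂ app (subst-id e t) (subst-id e s)
subst-id e (lam t)      = cong lam (subst-id (exts-id e) t)
subst-id e (efq t)      = cong efq (subst-id e t)
subst-id e (pair t s)   = cong₂ pair (subst-id e t) (subst-id e s)
subst-id e (proj i t)   = cong (proj i) (subst-id e t)
subst-id e (inj i t)    = cong (inj i) (subst-id e t)
subst-id e (case t s u) = cong₃ case (subst-id e t) (subst-id (exts-id e) s) (subst-id (exts-id e) u)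
subst-id e (hop t s u)  = cong₃ hop (subst-id (exts-id e) t) (subst-id (exts-id e) s) (subst-id (exts-id e) u)

subst-cong : ∀ {σ τ} → σ ≗ τ → ∀ t → subst σ t ≡ subst τ t
subst-cong {σ} e t = trans (sym (subst-id (λ _ → refl) (subst σ t)))
                           (subst-fusion (λ n → trans (subst-id (λ _ → refl) (σ n)) (e n)) t)

_∷ˢ_ : Term → (ℕ → Term) → ℕ → Term
(v ∷ˢ σ) zero    = v
(v ∷ˢ σ) (suc n) = σ n

single : Term → ℕ → Term
single s = s ∷ˢ var

[]-single : ∀ t s → t [ s ] ≡ subst (single s) t
[]-single t s = subst-cong (λ { zero → refl ; (suc n) → refl }) t

single-exts : ∀ σ t v → subst (single v) (subst (exts σ) t) ≡ subst (v ∷ˢ σ) t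
single-exts σ t v = subst-fusion pointwise t
  where
  pointwise : subst (single v) ∘ exts σ ≗ v ∷ˢ σ
  pointwise zero    = refl
  pointwise (suc n) = trans (subst-rename-fusion (λ _ → refl) (σ n)) (subst-id (λ _ → refl) (σ n))

subst-[] : ∀ σ t s → subst σ (t [ s ]) ≡ subst (exts σ) t [ subst σ s ]
subst-[] σ t s = begin
  subst σ (t [ s ])                               ≡⟨ cong (subst σ) ([]-single t s) ⟩
  subst σ (subst (single s) t)                    ≡⟨ subst-fusion (λ { zero → refl ; (suc n) → refl }) t ⟩
  subst (subst σ s ∷ˢ σ) t                        ≡⟨ sym (single-exts σ t (subst σ s)) ⟩
  subst (single (subst σ s)) (subst (exts σ) t)   ≡⟨ sym ([]-single (subst (exts σ) t) (subst σ s)) ⟩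
  subst (exts σ) t [ subst σ s ]                  ∎
  where open ≡-Reasoning

substW : (ℕ → Term) → WCtx → WCtx
substW σ □             = □
substW σ (appW W t)    = appW (substW σ W) (subst σ t)
substW σ (projW i W)   = projW i (substW σ W)
substW σ (caseW W s t) = caseW (substW σ W) (subst (exts σ) s) (subst (exts σ) t)

plug-subst : ∀ σ W e → subst σ (plug W e) ≡ plug (substW σ W) (subst σ e)
plug-subst σ □             e = refl
plug-subst σ (appW W t)    e = cong (λ x → app x (subst σ t)) (plug-subst σ W e)
plug-subst σ (projW i W)   e = cong (proj i) (plug-subst σ W e)
plug-subst σ (caseW W s t) e = cong (λ x → case x (subst (exts σ) s) (subst (exts σ) t)) (plug-subst σ W e)

retype : ∀ {a a' b b'} → a ≡ a' → b ≡ b' → a' ↦ b' → a ↦ b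
retype refl refl r = r

↦-subst : ∀ σ {t u} → t ↦ u → subst σ t ↦ subst σ u
↦-subst σ (β-⇒ {t} {s})                      = retype refl (subst-[] σ t s) β-⇒
↦-subst σ (β-∧ {one})                        = β-∧
↦-subst σ (β-∧ {two})                        = β-∧
↦-subst σ (β-∨ {one} {t} {s₁})               = retype refl (subst-[] σ s₁ t) β-∨
↦-subst σ (β-∨ {two} {t} {s₂ = s₂})          = retype refl (subst-[] σ s₂ t) β-∨
↦-subst σ (hop-in {one} {t} {s₁})            = retype refl (subst-[] σ s₁ (lam t)) hop-in
↦-subst σ (hop-in {two} {t} {s₂ = s₂})       = retype refl (subst-[] σ s₂ (lam t)) hop-in
↦-subst σ (hop-efq {W} {t} {s₁} {s₂})        =
  retype (cong (λ x → hop x (subst (exts σ) s₁) (subst (exts σ) s₂)) (plug-subst (exts σ) W (efq t)))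
         (subst-[] σ s₁ (lam (efq t))) hop-efq

⟶-subst : ∀ σ {t u} → t ⟶ u → subst σ t ⟶ subst σ u
⟶-subst σ (top r)   = top (↦-subst σ r)
⟶-subst σ (appˡ r)  = appˡ (⟶-subst σ r)
⟶-subst σ (appʳ r)  = appʳ (⟶-subst σ r)
⟶-subst σ (lamξ r)  = lamξ (⟶-subst (exts σ) r)
⟶-subst σ (efqξ r)  = efqξ (⟶-subst σ r)
⟶-subst σ (pairˡ r) = pairˡ (⟶-subst σ r)
⟶-subst σ (pairʳ r) = pairʳ (⟶-subst σ r)
⟶-subst σ (projξ r) = projξ (⟶-subst σ r)
⟶-subst σ (injξ r)  = injξ (⟶-subst σ r)
⟶-subst σ (case₀ r) = case₀ (⟶-subst σ r)
⟶-subst σ (case₁ r) = case₁ (⟶-subst (exts σ) r)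
⟶-subst σ (case₂ r) = case₂ (⟶-subst (exts σ) r)
⟶-subst σ (hop₀ r)  = hop₀ (⟶-subst (exts σ) r)
⟶-subst σ (hop₁ r)  = hop₁ (⟶-subst (exts σ) r)
⟶-subst σ (hop₂ r)  = hop₂ (⟶-subst (exts σ) r)

plug-⟶ : ∀ W {t u} → t ⟶ u → plug W t ⟶ plug W u
plug-⟶ □             r = r
plug-⟶ (appW W s)    r = appˡ (plug-⟶ W r)
plug-⟶ (projW i W)   r = projξ (plug-⟶ W r)
plug-⟶ (caseW W s u) r = case₀ (plug-⟶ W r)

SN-step : ∀ {t u} → SN t → t ⟶ u → SN u
SN-step (sn h) r = h r

SN-reflect : (f : Term → Term) → (∀ {t u} → t ⟶ u → f t ⟶ f u) → ∀ {t} → SN (f t) → SN t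
SN-reflect f f-⟶ (sn h) = sn (λ r → SN-reflect f f-⟶ (h (f-⟶ r)))

SN-plug : ∀ W {e} → SN (plug W e) → SN e
SN-plug W = SN-reflect (plug W) (plug-⟶ W)

-- Injections create no new redexes.
SN-inj : ∀ {i t} → SN t → SN (inj i t)
SN-inj (sn h) = sn λ { (top ()) ; (injξ r) → SN-inj (h r) }

_⟶*_ : Term → Term → Set
_⟶*_ = Star _⟶_

-- The disjunction clause asks
-- for SN together with reducibility of every injection argument reachable
-- by reduction, which is what case and hop consume.
Red : Formula → Term → Set
Red (atom _) t = SN t
Red ⊥'       t = SN t
Red (A ⇒ B)  t = ∀ s → Red A s → Red B (app t s)
Red (A ∧ B)  t = Red A (proj one t) × Red B (proj two t)
Red (A ∨ B)  t = SN t × ((∀ {u} → t ⟶* inj one u → Red A u) × (∀ {u} → t ⟶* inj two u → Red B u))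

∧-red-proj : ∀ {A B t} → Red (A ∧ B) t → ∀ i → Red (pick i A B) (proj i t)
∧-red-proj r one = proj₁ r
∧-red-proj r two = proj₂ r

∨-red : ∀ {A B t} → SN t → (∀ i {u} → t ⟶* inj i u → Red (pick i A B) u) → Red (A ∨ B) t
∨-red snt h = snt , h one , h two

∨-red-inj : ∀ {A B t} → Red (A ∨ B) t → ∀ i {u} → t ⟶* inj i u → Red (pick i A B) u
∨-red-inj (_ , h₁ , h₂) one = h₁
∨-red-inj (_ , h₁ , h₂) two = h₂

-- Terms that are not introductions: placing them in an elimination
-- position never creates a top-level redex.
data Neutral : Term → Set where
  nvar  : ∀ {n} → Neutral (var n)
  napp  : ∀ {t s} → Neutral (app t s)
  nefq  : ∀ {t} → Neutral (efq t)
  nproj : ∀ {i t} → Neutral (proj i t)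
  ncase : ∀ {t s u} → Neutral (case t s u)
  nhop  : ∀ {t s u} → Neutral (hop t s u)

neutral-proj : ∀ {A B t u} i → Neutral t → (∀ {t'} → t ⟶ t' → Red (A ∧ B) t') →
               proj i t ⟶ u → Red (pick i A B) u
neutral-proj i () h (top β-∧)
neutral-proj i n  h (projξ r) = ∧-red-proj (h r) i

-- A neutral term can only reach an injection by a first reduction step.
neutral-inj : ∀ {A B t} → Neutral t → (∀ {t'} → t ⟶ t' → Red (A ∨ B) t') →
              ∀ i {u} → t ⟶* inj i u → Red (pick i A B) u
neutral-inj () h i ε
neutral-inj n  h i (r ◅ rs) = ∨-red-inj (h r) i rs

mutual
  CR1 : ∀ A {t} → Red A t → SN t
  CR1 (atom _) r = r
  CR1 ⊥'       r = r
  CR1 (A ⇒ B)  r = SN-reflect (λ t → app t (var 0)) appˡ (CR1 B (r (var 0) (var-red A)))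
  CR1 (A ∧ B)  r = SN-reflect (proj one) projξ (CR1 A (proj₁ r))
  CR1 (A ∨ B)  r = proj₁ r

  var-red : ∀ A {n} → Red A (var n)
  var-red A = CR3 A nvar λ { (top ()) }

  CR2 : ∀ A {t u} → Red A t → t ⟶ u → Red A u
  CR2 (atom _) r s     = SN-step r s
  CR2 ⊥'       r s     = SN-step r s
  CR2 (A ⇒ B)  r s v rv = CR2 B (r v rv) (appˡ s)
  CR2 (A ∧ B)  r s     = CR2 A (proj₁ r) (projξ s) , CR2 B (proj₂ r) (projξ s)
  CR2 (A ∨ B)  r s     = ∨-red (SN-step (proj₁ r) s) λ i rs → ∨-red-inj r i (s ◅ rs)

  CR3 : ∀ A {t} → Neutral t → (∀ {u} → t ⟶ u → Red A u) → Red A t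
  CR3 (atom _) n h      = sn h
  CR3 ⊥'       n h      = sn h
  CR3 (A ⇒ B)  n h s rs = neutral-app n h (CR1 A rs) rs
  CR3 (A ∧ B)  n h      = CR3 A nproj (neutral-proj one n h) , CR3 B nproj (neutral-proj two n h)
  CR3 (A ∨ B)  n h      = ∨-red (sn (λ r → proj₁ (h r))) (neutral-inj n h)

  -- The ⇒ case of CR3, by induction on the strong normalization of the argument.
  neutral-app : ∀ {A B t s} → Neutral t → (∀ {u} → t ⟶ u → Red (A ⇒ B) u) →
                SN s → Red A s → Red B (app t s)
  neutral-app {B = B} n h sns rs = CR3 B napp (neutral-app-reduct n h sns rs)

  neutral-app-reduct : ∀ {A B t s u} → Neutral t → (∀ {t'} → t ⟶ t' → Red (A ⇒ B) t') →
                       SN s → Red A s → app t s ⟶ u → Red B u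
  neutral-app-reduct         ()  h sns     rs (top β-⇒)
  neutral-app-reduct         n   h sns     rs (appˡ r) = h r _ rs
  neutral-app-reduct {A = A} n   h (sn hs) rs (appʳ r) = neutral-app n h (hs r) (CR2 A rs r)

record RedBody (A B : Formula) (T : Term) : Set where
  constructor red-body
  field instantiate : ∀ v → Red A v → Red B (subst (single v) T)
open RedBody

RedBody-[] : ∀ {A B T v} → RedBody A B T → Red A v → Red B (T [ v ])
RedBody-[] {B = B} {T} {v} h rv = ≡.subst (Red B) (sym ([]-single T v)) (instantiate h v rv)

-- Instantiating with the (reducible) variable 0 shows the body is SN.
RedBody-SN : ∀ {A B T} → RedBody A B T → SN T
RedBody-SN {A} {B} h = SN-reflect (subst (single (var 0))) (⟶-subst (single (var 0)))
                                  (CR1 B (instantiate h (var 0) (var-red A)))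

RedBody-⟶ : ∀ {A B T T'} → RedBody A B T → T ⟶ T' → RedBody A B T'
RedBody-⟶ {B = B} h r = red-body λ v rv → CR2 B (instantiate h v rv) (⟶-subst (single v) r)

-- Every proof is an induction on the strong
-- normalization of the immediate subterms, using CR3 at neutral terms.

efq-red : ∀ A {t} → SN t → Red A (efq t)
efq-red A (sn h) = CR3 A nefq λ { (top ()) ; (efqξ r) → efq-red A (h r) }

lam-red : ∀ {A B T} → RedBody A B T → Red (A ⇒ B) (lam T)
lam-red {A} {B} h s rs = go (RedBody-SN h) (CR1 A rs) h rs
  where
  go : ∀ {T s} → SN T → SN s → RedBody A B T → Red A s → Red B (app (lam T) s)
  go snT@(sn hT) sns@(sn hs) h rs = CR3 B napp λ
    { (top β-⇒)          → RedBody-[] h rs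
    ; (appˡ (top ()))
    ; (appˡ (lamξ r))    → go (hT r) sns (RedBody-⟶ h r) rs
    ; (appʳ r)           → go snT (hs r) h (CR2 A rs r) }

pair-red : ∀ {A B T S} → Red A T → Red B S → Red (A ∧ B) (pair T S)
pair-red {A} {B} rT rS = go one (CR1 A rT) (CR1 B rS) rT rS , go two (CR1 A rT) (CR1 B rS) rT rS
  where
  select-red : ∀ i {T S} → Red A T → Red B S → Red (pick i A B) (select i T S)
  select-red one rT rS = rT
  select-red two rT rS = rS

  go : ∀ i {T S} → SN T → SN S → Red A T → Red B S → Red (pick i A B) (proj i (pair T S))
  go i snT@(sn hT) snS@(sn hS) rT rS = CR3 (pick i A B) nproj λ
    { (top β-∧)          → select-red i rT rS
    ; (projξ (top ()))
    ; (projξ (pairˡ r))  → go i (hT r) snS (CR2 A rT r) rS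
    ; (projξ (pairʳ r))  → go i snT (hS r) rT (CR2 B rS r) }

inj-red : ∀ {A B} i {T} → Red (pick i A B) T → Red (A ∨ B) (inj i T)
inj-red {A} {B} i r = ∨-red (SN-inj (CR1 (pick i A B) r)) (reducts r)
  where
  reducts : ∀ {i T} → Red (pick i A B) T → ∀ j {u} → inj i T ⟶* inj j u → Red (pick j A B) u
  reducts r j ε                  = r
  reducts r j (top () ◅ _)
  reducts {i} r j (injξ s ◅ rs)  = reducts (CR2 (pick i A B) r s) j rs

case-red : ∀ {A₁ A₂ D T S₁ S₂} → Red (A₁ ∨ A₂) T → RedBody A₁ D S₁ → RedBody A₂ D S₂ →
           Red D (case T S₁ S₂)
case-red {A₁} {A₂} {D} rT h₁ h₂ = go (CR1 (A₁ ∨ A₂) rT) (RedBody-SN h₁) (RedBody-SN h₂) rT h₁ h₂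
  where
  go : ∀ {T S₁ S₂} → SN T → SN S₁ → SN S₂ → Red (A₁ ∨ A₂) T → RedBody A₁ D S₁ → RedBody A₂ D S₂ →
       Red D (case T S₁ S₂)
  go snT@(sn hT) snS₁@(sn hS₁) snS₂@(sn hS₂) rT h₁ h₂ = CR3 D ncase λ
    { (top (β-∨ {one})) → RedBody-[] h₁ (∨-red-inj rT one ε)
    ; (top (β-∨ {two})) → RedBody-[] h₂ (∨-red-inj rT two ε)
    ; (case₀ r) → go (hT r) snS₁ snS₂ (CR2 (A₁ ∨ A₂) rT r) h₁ h₂
    ; (case₁ r) → go snT (hS₁ r) snS₂ rT (RedBody-⟶ h₁ r) h₂
    ; (case₂ r) → go snT snS₁ (hS₂ r) rT h₁ (RedBody-⟶ h₂ r) }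

inj-body : ∀ {C A₁ A₂} i {t} → RedBody C (A₁ ∨ A₂) (inj i t) → RedBody C (pick i A₁ A₂) t
inj-body i h = red-body λ v rv → ∨-red-inj (instantiate h v rv) i ε

-- A reducible body of the form W⟨efq w⟩ (at any type) makes efq w a
-- reducible body at every type: its instances are SN, hence reducible.
efq-body : ∀ {C D} A W {w} → RedBody C D (plug W (efq w)) → RedBody C A (efq w)
efq-body {D = D} A W {w} h = red-body λ v rv →
  efq-red A (SN-reflect efq efqξ (SN-plug (substW (single v) W)
    (≡.subst SN (plug-subst (single v) W (efq w)) (CR1 D (instantiate h v rv)))))

-- The Harrop rule: both top-level hop-reductions substitute a λ-abstraction
-- of (part of) the first body, reducible at ¬B ⇒ Aᵢ by the lemmas above.
hop-red : ∀ {B A₁ A₂ D T S₁ S₂} → RedBody (¬' B) (A₁ ∨ A₂) T →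
          RedBody (¬' B ⇒ A₁) D S₁ → RedBody (¬' B ⇒ A₂) D S₂ → Red D (hop T S₁ S₂)
hop-red {B} {A₁} {A₂} {D} hT h₁ h₂ = go (RedBody-SN hT) (RedBody-SN h₁) (RedBody-SN h₂) hT h₁ h₂
  where
  go : ∀ {T S₁ S₂} → SN T → SN S₁ → SN S₂ → RedBody (¬' B) (A₁ ∨ A₂) T →
       RedBody (¬' B ⇒ A₁) D S₁ → RedBody (¬' B ⇒ A₂) D S₂ → Red D (hop T S₁ S₂)
  go snT@(sn hT') snS₁@(sn hS₁) snS₂@(sn hS₂) hT h₁ h₂ = CR3 D nhop λ
    { (top (hop-in {one}))     → RedBody-[] h₁ (lam-red (inj-body one hT))
    ; (top (hop-in {two}))     → RedBody-[] h₂ (lam-red (inj-body two hT))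
    ; (top (hop-efq {W}))      → RedBody-[] h₁ (lam-red (efq-body A₁ W hT))
    ; (hop₀ r) → go (hT' r) snS₁ snS₂ (RedBody-⟶ hT r) h₁ h₂
    ; (hop₁ r) → go snT (hS₁ r) snS₂ hT (RedBody-⟶ h₁ r) h₂
    ; (hop₂ r) → go snT snS₁ (hS₂ r) hT h₁ (RedBody-⟶ h₂ r) }

RedSubst : Context → (ℕ → Term) → Set
RedSubst Γ σ = ∀ {n A} → Γ ∋ n ∶ A → Red A (σ n)

RedSubst-∷ : ∀ {Γ σ A v} → RedSubst Γ σ → Red A v → RedSubst (A ∷ Γ) (v ∷ˢ σ)
RedSubst-∷ e rv here      = rv
RedSubst-∷ e rv (there x) = e x

mutual
  fundamental : ∀ {Γ t A σ} → Γ ⊢ t ∶ A → RedSubst Γ σ → Red A (subst σ t)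
  fundamental (ax x)          e = e x
  fundamental (⇒I d)          e = lam-red (body d e)
  fundamental (⇒E d d')       e = fundamental d e _ (fundamental d' e)
  fundamental (∧I d d')       e = pair-red (fundamental d e) (fundamental d' e)
  fundamental (∧E i d)        e = ∧-red-proj (fundamental d e) i
  fundamental (∨I i d)        e = inj-red i (fundamental d e)
  fundamental (∨E d d₁ d₂)    e = case-red (fundamental d e) (body d₁ e) (body d₂ e)
  fundamental (⊥E {A = A} d)  e = efq-red A (fundamental d e)
  fundamental (harrop d d₁ d₂) e = hop-red (body d e) (body d₁ e) (body d₂ e)

  body : ∀ {Γ t A B σ} → (A ∷ Γ) ⊢ t ∶ B → RedSubst Γ σ → RedBody A B (subst (exts σ) t)
  body {t = t} {B = B} {σ} d e = red-body λ v rv →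
    ≡.subst (Red B) (sym (single-exts σ t v)) (fundamental d (RedSubst-∷ e rv))

mainTheorem7 : ∀ {Γ t A} → Γ ⊢ t ∶ A → SN t
mainTheorem7 {t = t} {A} d = CR1 A (≡.subst (Red A) (subst-id (λ _ → refl) t) reducible)
  where
  reducible : Red A (subst var t)
  reducible = fundamental d (λ {_} {B} _ → var-red B)
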